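{- Let $V$ be an unweighted digraph without loops on the vertex set $\mathcal N$, $|\mathcal N|=N$, and let $k\in\{2,\dots,N\}$ be such that $\mathcal F^k\neq\emptyset$ and $\mathcal F^{k-1}=\emptyset$. Let $\mathcal E$ be an atom of the algebra $\mathfrak A_k$. Then for every $F\in\mathcal F^k$ the induced subgraph $F|_{\mathcal E}$ is a tree.
   Context: An (entering) forest is a digraph in which at most one arc leaves each vertex and which contains no directed cycle; its weakly connected components are (entering) trees, the root of a tree being its unique vertex with no outgoing arc (a single vertex without arcs is a tree). A spanning forest of $V$ is a subgraph of $V$ which is a forest with vertex set $\mathcal N$; $\mathcal F^k$ denotes the set of spanning forests of $V$ with exactly $k$ trees. $\mathfrak A_k$ is the algebra of subsets of $\mathcal N$ generated (by complements and intersections) by the vertex sets of all trees of all forests in $\mathcal F^k$; an atom is a nonempty $\mathcal A\in\mathfrak A_k$ with $\mathcal A\cap\mathcal B\in\{\emptyset,\mathcal A\}$ for all $\mathcal B\in\mathfrak A_k$. $F|_{\mathcal E}$ is the subgraph of $F$ induced by $\mathcal E$ (vertex set $\mathcal E$, all arcs of $F$ with both ends in $\mathcal E$). -}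

module Defs where

open import Level using (0ℓ)
open import Data.Nat using (ℕ; _∸_)
open import Data.Fin using (Fin)
open import Data.Fin.Subset using (Subset; _∈_; ∁; _∩_; Nonempty) renaming (⊥ to ∅ˢ; ⊤ to fullˢ)
open import Data.Product using (Σ; ∃; _×_; _,_)
open import Data.Sum using (_⊎_)
open import Relation.Nullary using (¬_)
open import Relation.Binary.PropositionalEquality using (_≡_)
open import Relation.Binary.Construct.Closure.ReflexiveTransitive using (Star)
open import Relation.Binary.Construct.Closure.Symmetric using (SymClosure)
open import Relation.Binary.Construct.Closure.Transitive using (TransClosure)
open import Function.Bundles using (_⇔_)

Arcs : ℕ → Set₁
Arcs N = Fin N → Fin N → Set

Loopless : ∀ {N} → Arcs N → Set
Loopless V = ∀ i → ¬ V i i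

SubgraphOf : ∀ {N} → Arcs N → Arcs N → Set
SubgraphOf R V = ∀ i j → R i j → V i j

ArcsWithin : ∀ {N} → Subset N → Arcs N → Set
ArcsWithin S R = ∀ i j → R i j → (i ∈ S) × (j ∈ S)

OutDegAtMostOne : ∀ {N} → Arcs N → Set
OutDegAtMostOne R = ∀ i j j′ → R i j → R i j′ → j ≡ j′

Acyclic : ∀ {N} → Arcs N → Set
Acyclic R = ∀ i → ¬ TransClosure R i i

IsForest : ∀ {N} → Subset N → Arcs N → Set
IsForest S R = ArcsWithin S R × OutDegAtMostOne R × Acyclic R

WConn : ∀ {N} → Arcs N → Fin N → Fin N → Set
WConn R = Star (SymClosure R)

IsTree : ∀ {N} → Subset N → Arcs N → Set
IsTree S R = IsForest S R × Nonempty S × (∀ i j → i ∈ S → j ∈ S → WConn R i j)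

SpanningForest : ∀ {N} → Arcs N → Arcs N → Set
SpanningForest V R = SubgraphOf R V × IsForest fullˢ R

-- R has exactly k trees: its weakly connected components are labelled
-- bijectively by Fin k
HasTrees : ∀ {N} → ℕ → Arcs N → Set
HasTrees {N} k R =
  Σ (Fin N → Fin k) λ c →
    (∀ t → ∃ λ i → c i ≡ t) × (∀ i j → (c i ≡ c j) ⇔ WConn R i j)

InFk : ∀ {N} → Arcs N → ℕ → Arcs N → Set
InFk V k R = SpanningForest V R × HasTrees k R

FkNonempty : ∀ {N} → Arcs N → ℕ → Set₁
FkNonempty V k = Σ (Arcs _) λ R → InFk V k R

TreeVertexSet : ∀ {N} → Arcs N → ℕ → Subset N → Set₁
TreeVertexSet V k T =
  Σ (Arcs _) λ R → InFk V k R × ∃ λ i → ∀ j → (j ∈ T) ⇔ WConn R i j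

data InAlgebra {N} (V : Arcs N) (k : ℕ) : Subset N → Set₁ where
  gen   : ∀ {T} → TreeVertexSet V k T → InAlgebra V k T
  compl : ∀ {A} → InAlgebra V k A → InAlgebra V k (∁ A)
  inter : ∀ {A B} → InAlgebra V k A → InAlgebra V k B → InAlgebra V k (A ∩ B)

IsAtom : ∀ {N} → Arcs N → ℕ → Subset N → Set₁
IsAtom V k E =
  Nonempty E × InAlgebra V k E ×
  (∀ B → InAlgebra V k B → (E ∩ B ≡ ∅ˢ) ⊎ (E ∩ B ≡ E))

Induced : ∀ {N} → Arcs N → Subset N → Arcs N
Induced R E i j = (i ∈ E) × (j ∈ E) × R i j

-- Since 𝓕^(k-1) = ∅, a root of a forest in 𝓕^k has all its V-out-neighbours in its own tree
-- (attaching it elsewhere would merge two trees), and rerooting the tree at such a neighbour keeps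
-- the trees; so whatever is V-reachable from a root lies in its tree. Every tree is a generator of
-- 𝔄_k, hence the atom E lies inside one tree of each forest. The key step: if a ∈ E has its F-parent
-- x outside E, then every b ∈ E lies below a in F. Otherwise take G ∈ 𝓕^k separating a from x, which
-- exists as E is an atom; redirecting single arcs shows that the F-root r of b lies below a in every
-- such G, and the V-paths r → a → x → (G-root of x) → r put a and x into one tree of G. Consequently,
-- walking up from i ∈ E towards the meeting point with j ∈ E stays in E until it passes above j, so
-- F|_E is connected.

module Submission where

open import Defs

open import Level using (0ℓ)
open import Data.Empty using (⊥; ⊥-elim)
open import Data.Nat using (ℕ; zero; suc; _≤_; _<_; _∸_; _+_; z≤n; s≤s; s≤s⁻¹)
import Data.Nat.Properties as ℕ
open import Data.Fin using (Fin; zero; suc; toℕ; _≟_; punchIn; punchOut)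
import Data.Fin.Properties as Fin
open import Data.Fin.Subset using (Subset; _∈_; _∉_; ∁; _∩_; Nonempty)
open import Data.Fin.Subset.Properties using (∈⊤; _∈?_; ∉⊥; x∈p∩q⁺; x∈p∩q⁻; x∈∁p⇒x∉p; x∉∁p⇒x∈p)
open import Data.Maybe using (Maybe; just; nothing; fromMaybe)
open import Data.Maybe.Properties using (just-injective)
open import Data.Product using (Σ; ∃; _×_; _,_; proj₁; proj₂)
open import Data.Sum using (_⊎_; inj₁; inj₂; [_,_]′)
open import Data.Vec using (tabulate)
open import Data.Vec.Properties using ([]=⇒lookup; lookup⇒[]=; lookup∘tabulate)
open import Data.Vec.Functional using (updateAt)
open import Data.Vec.Functional.Properties using (updateAt-updates; updateAt-minimal)
open import Function using (flip; case_of_; _∘_; const)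
open import Function.Bundles using (_⇔_; mk⇔; Equivalence)
open import Induction.WellFounded using (Acc; acc; acc⇒asym)
open import Relation.Binary using (Rel; _⇒_)
open import Relation.Binary.Definitions using (DecidableEquality)
open import Relation.Binary.Rewriting using (Deterministic)
open import Relation.Binary.PropositionalEquality
open import Relation.Binary.Construct.Closure.ReflexiveTransitive using (Star; ε; _◅_; _◅◅_)
import Relation.Binary.Construct.Closure.ReflexiveTransitive as Star
open import Relation.Binary.Construct.Closure.Symmetric using (SymClosure; fwd; bwd)
import Relation.Binary.Construct.Closure.Symmetric as Sym
open import Relation.Binary.Construct.Closure.Transitive using (TransClosure; [_]; _∷_; _∷ʳ_)
import Relation.Binary.Construct.Closure.Transitive as Plus
open import Relation.Nullary using (¬_; Dec; yes; no; contradiction)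
open import Relation.Nullary.Negation using (¬¬-map)
open import Relation.Nullary.Decidable using (does; dec-true; ¬¬-excluded-middle)

module _ {A : Set} {R : Rel A 0ℓ} where

  _◅⁺_ : ∀ {u w v} → R u w → Star R w v → TransClosure R u v
  r ◅⁺ ε = [ r ]
  r ◅⁺ (r′ ◅ s) = r ∷ (r′ ◅⁺ s)

  *-first-step : ∀ {u v} → Star R u v → u ≢ v → ∃ (R u)
  *-first-step ε u≢u = contradiction refl u≢u
  *-first-step (r ◅ _) _ = _ , r

  acyclic⇒antisym : (∀ u → ¬ TransClosure R u u) → ∀ {u v} → Star R u v → Star R v u → u ≡ v
  acyclic⇒antisym acyclic ε t = refl
  acyclic⇒antisym acyclic (r ◅ s) t = ⊥-elim (acyclic _ (r ◅⁺ (s ◅◅ t)))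

⁺-map : ∀ {A : Set} {R S : Rel A 0ℓ} → R ⇒ S → TransClosure R ⇒ TransClosure S
⁺-map f [ r ] = [ f r ]
⁺-map f (r ∷ t) = f r ∷ ⁺-map f t

⁺-reverse : ∀ {A : Set} {R : Rel A 0ℓ} {u v} → TransClosure R u v → TransClosure (flip R) v u
⁺-reverse [ r ] = [ r ]
⁺-reverse (r ∷ t) = ⁺-reverse t ∷ʳ r

module DeterministicRelation {A : Set} (R : Rel A 0ℓ) (det : Deterministic _≡_ R) where

  wconn⇒meet : ∀ {i j} → Star (SymClosure R) i j → ∃ λ m → Star R i m × Star R j m
  wconn⇒meet {i} ε = i , ε , ε
  wconn⇒meet (fwd r ◅ w) with wconn⇒meet w
  ... | m , s , t = m , r ◅ s , t
  wconn⇒meet (bwd r ◅ w) with wconn⇒meet w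
  ... | m , ε , t = _ , ε , (t ◅◅ (r ◅ ε))
  ... | m , (r′ ◅ s) , t with det r r′
  ...   | refl = m , s , t

  *-tail : ∀ {u v w} → Star R u v → u ≢ v → R u w → Star R w v
  *-tail ε u≢u r = contradiction refl u≢u
  *-tail (r′ ◅ s) u≢v r with det r r′
  ... | refl = s

  module _ (_≟ᴬ_ : DecidableEquality A) (acyclic : ∀ u → ¬ TransClosure R u u) where

    *-dec-on-path : ∀ {j v m} → Star R j m → Star R v m → Dec (Star R j v)
    *-dec-on-path {j} {v} jm vm with j ≟ᴬ v
    ... | yes refl = yes ε
    *-dec-on-path ε vm | no j≢v = no λ jv → j≢v (acyclic⇒antisym acyclic jv vm)
    *-dec-on-path (r ◅ jm) vm | no j≢v with *-dec-on-path jm vm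
    ... | yes s = yes (r ◅ s)
    ... | no ¬s = no λ jv → ¬s (*-tail jv j≢v r)

Parent : ℕ → Set
Parent N = Fin N → Maybe (Fin N)

module ParentMap {N : ℕ} (p : Parent N) where

  infix 4 _↦_ _↦*_

  _↦_ : Rel (Fin N) 0ℓ
  u ↦ w = p u ≡ just w

  _↦*_ : Rel (Fin N) 0ℓ
  _↦*_ = Star _↦_

  IsRoot : Fin N → Set
  IsRoot u = p u ≡ nothing

  Terminating : Fin N → Set
  Terminating = Acc (flip _↦_)

  ↦-deterministic : Deterministic _≡_ _↦_
  ↦-deterministic e e′ = just-injective (trans (sym e) e′)

  open DeterministicRelation _↦_ ↦-deterministic public

  root-¬↦ : ∀ {u w} → IsRoot u → ¬ u ↦ w
  root-¬↦ e r with trans (sym e) r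
  ... | ()

  root-↦* : ∀ {u v} → IsRoot u → u ↦* v → u ≡ v
  root-↦* e ε = refl
  root-↦* e (r ◅ _) = contradiction r (root-¬↦ e)

  _↦*?_ : ∀ {u} → Terminating u → ∀ v → Dec (u ↦* v)
  _↦*?_ {u} (acc rs) v with u ≟ v
  ... | yes refl = yes ε
  ... | no u≢v with p u in eq
  ...   | nothing = no λ { ε → u≢v refl ; (r ◅ _) → root-¬↦ eq r }
  ...   | just w with rs refl ↦*? v
  ...     | yes s = yes (eq ◅ s)
  ...     | no ¬s = no λ { ε → u≢v refl ; (r ◅ s) → ¬s (subst (_↦* v) (↦-deterministic r eq) s) }

  rootOf : ∀ {u} → Terminating u → ∃ λ r → IsRoot r × u ↦* r
  rootOf {u} (acc rs) with p u in eq
  ... | nothing = u , eq , ε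
  ... | just w with rootOf (rs refl)
  ...   | r , root , s = r , root , (eq ◅ s)

  terminating⇒acyclic : (∀ u → Terminating u) → ∀ u → ¬ TransClosure _↦_ u u
  terminating⇒acyclic terminating u cycle =
    acc⇒asym (Plus.accessible (flip _↦_) (terminating u)) (⁺-reverse cycle) (⁺-reverse cycle)

  next : Fin N → Fin N
  next u = fromMaybe u (p u)

  walk : ℕ → Fin N → Fin N
  walk zero u = u
  walk (suc n) u = next (walk n u)

  root⇒next≡ : ∀ {u} → IsRoot u → next u ≡ u
  root⇒next≡ e rewrite e = refl

  ¬root⇒↦next : ∀ {u} → ¬ IsRoot u → u ↦ next u
  ¬root⇒↦next {u} ¬root with p u in eq
  ... | nothing = contradiction refl ¬root
  ... | just w = refl

  root-terminating : ∀ {u} → IsRoot u → Terminating u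
  root-terminating e = acc λ r → contradiction r (root-¬↦ e)

  next-terminating : ∀ {u} → Terminating (next u) → Terminating u
  next-terminating {u} t with p u in eq
  ... | nothing = root-terminating eq
  ... | just w = acc λ r → subst Terminating (↦-deterministic eq r) t

  walk-terminating : ∀ n {u} → Terminating (walk n u) → Terminating u
  walk-terminating zero t = t
  walk-terminating (suc n) t = walk-terminating n (next-terminating t)

  walk-root : ∀ d {t u} → IsRoot (walk t u) → IsRoot (walk (d + t) u)
  walk-root zero e = e
  walk-root (suc d) e = trans (cong p (root⇒next≡ (walk-root d e))) (walk-root d e)

  walk-↦⁺ : ∀ {u i j} → i < j → (∀ t → t < j → ¬ IsRoot (walk t u)) →
            TransClosure _↦_ (walk i u) (walk j u)
  walk-↦⁺ {j = suc j} (s≤s i≤j) ¬root with ℕ.m≤n⇒m<n∨m≡n i≤j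
  ... | inj₁ i<j = walk-↦⁺ i<j (λ t t<j → ¬root t (ℕ.m<n⇒m<1+n t<j)) ∷ʳ ¬root⇒↦next (¬root j (ℕ.n<1+n j))
  ... | inj₂ refl = [ ¬root⇒↦next (¬root j (ℕ.n<1+n j)) ]

  -- Among walk 0 u, …, walk N u two vertices coincide; unless a root occurs, the walk between them
  -- is a cycle.
  acyclic⇒terminating : (∀ u → ¬ TransClosure _↦_ u u) → ∀ u → Terminating u
  acyclic⇒terminating acyclic u with p (walk N u) in e
  ... | nothing = walk-terminating N (root-terminating e)
  ... | just _ with Fin.pigeonhole (ℕ.n<1+n N) (λ i → walk (toℕ i) u)
  ...   | i , j , i<j , walkᵢ≡walkⱼ =
    ⊥-elim (acyclic (walk (toℕ i) u) (subst (TransClosure _↦_ _) (sym walkᵢ≡walkⱼ) (walk-↦⁺ i<j ¬root)))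
    where
      ¬root : ∀ t → t < toℕ j → ¬ IsRoot (walk t u)
      ¬root t t<j root = case trans (sym e) rootN of λ ()
        where
          t≤N : t ≤ N
          t≤N = ℕ.<⇒≤ (ℕ.<-≤-trans t<j (s≤s⁻¹ (Fin.toℕ<n j)))
          rootN : IsRoot (walk N u)
          rootN = subst (λ n → IsRoot (walk n u)) (ℕ.m∸n+n≡m t≤N) (walk-root (N ∸ t) root)

-- Forests given as parent maps with numbered trees

¬¬-Π-Fin : ∀ {n} {P : Fin n → Set} → (∀ i → ¬ ¬ P i) → ¬ ¬ (∀ i → P i)
¬¬-Π-Fin {zero} h k = k λ ()
¬¬-Π-Fin {suc n} h k = h zero λ p₀ → ¬¬-Π-Fin (h ∘ suc) λ ps → k λ { zero → p₀ ; (suc i) → ps i }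

_Represents_ : ∀ {N} → Parent N → Arcs N → Set
p Represents F = ∀ u w → (p u ≡ just w) ⇔ F u w

¬¬-parentMap : ∀ {N} {F : Arcs N} → OutDegAtMostOne F → ¬ ¬ (Σ (Parent N) (_Represents F))
¬¬-parentMap {N} {F} outdeg = ¬¬-map (λ d → (parentOf ∘ d) , λ u w → represents (d u))
                                      (¬¬-Π-Fin λ u → ¬¬-excluded-middle)
  where
    parentOf : ∀ {u} → Dec (∃ (F u)) → Maybe (Fin N)
    parentOf (yes (w , _)) = just w
    parentOf (no _) = nothing

    represents : ∀ {u w} (d : Dec (∃ (F u))) → (parentOf d ≡ just w) ⇔ F u w
    represents (yes (w , Fuw)) = mk⇔ (λ { refl → Fuw }) (cong just ∘ outdeg _ _ _ Fuw)
    represents (no ¬Fu) = mk⇔ (λ ()) (λ Fuw → contradiction (_ , Fuw) ¬Fu)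

module Identify {n} {i j : Fin (suc n)} (i≢j : i ≢ j) where

  redirect : Fin (suc n) → Σ (Fin (suc n)) (i ≢_)
  redirect t with t ≟ i
  ... | yes _ = j , i≢j
  ... | no t≢i = t , t≢i ∘ sym

  redirect-i : proj₁ (redirect i) ≡ j
  redirect-i with i ≟ i
  ... | yes _ = refl
  ... | no i≢i = contradiction refl i≢i

  redirect-fixes : ∀ {t} → t ≢ i → proj₁ (redirect t) ≡ t
  redirect-fixes {t} t≢i with t ≟ i
  ... | yes t≡i = contradiction t≡i t≢i
  ... | no _ = refl

  identify : Fin (suc n) → Fin n
  identify t = punchOut (proj₂ (redirect t))

  identify-i≡j : identify i ≡ identify j
  identify-i≡j = Fin.punchOut-cong i (trans redirect-i (sym (redirect-fixes (i≢j ∘ sym))))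

  identify-injective : ∀ {t t′} → t ≢ i → t′ ≢ i → identify t ≡ identify t′ → t ≡ t′
  identify-injective {t} {t′} t≢i t′≢i eq = begin
    t                     ≡⟨ sym (redirect-fixes t≢i) ⟩
    proj₁ (redirect t)    ≡⟨ Fin.punchOut-injective (proj₂ (redirect t)) (proj₂ (redirect t′)) eq ⟩
    proj₁ (redirect t′)   ≡⟨ redirect-fixes t′≢i ⟩
    t′                    ∎
    where open ≡-Reasoning

  identify-surjective : ∀ s → identify (punchIn i s) ≡ s
  identify-surjective s =
    trans (Fin.punchOut-cong i (redirect-fixes (Fin.punchInᵢ≢i i s))) (Fin.punchOut-punchIn i)

module Update {N} (p : Parent N) (x : Fin N) (new : Maybe (Fin N)) where

  p′ : Parent N
  p′ = updateAt p x (const new)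

  open ParentMap p
  open ParentMap p′ using () renaming (_↦_ to _↦′_; _↦*_ to _↦′*_; Terminating to Terminating′)

  p′-at : p′ x ≡ new
  p′-at = updateAt-updates x p

  p′-elsewhere : ∀ {u} → u ≢ x → p′ u ≡ p u
  p′-elsewhere u≢x = updateAt-minimal _ x p u≢x

  ↦′-cases : ∀ {u w} → u ↦′ w → (u ≡ x × new ≡ just w) ⊎ (u ≢ x × u ↦ w)
  ↦′-cases {u} e with u ≟ x
  ... | yes refl = inj₁ (refl , trans (sym p′-at) e)
  ... | no u≢x = inj₂ (u≢x , trans (sym (p′-elsewhere u≢x)) e)

  root′-cases : ∀ {r} → p′ r ≡ nothing → (r ≡ x × new ≡ nothing) ⊎ (r ≢ x × IsRoot r)
  root′-cases {r} e with r ≟ x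
  ... | yes refl = inj₁ (refl , trans (sym p′-at) e)
  ... | no r≢x = inj₂ (r≢x , trans (sym (p′-elsewhere r≢x)) e)

  ↦′*-avoiding : ∀ {v u} → ¬ v ↦* x → v ↦′* u → v ↦* u
  ↦′*-avoiding v↛x ε = ε
  ↦′*-avoiding v↛x (e ◅ s) with ↦′-cases e
  ... | inj₁ (refl , _) = contradiction ε v↛x
  ... | inj₂ (_ , r) = r ◅ ↦′*-avoiding (v↛x ∘ (r ◅_)) s

  terminating-avoiding : ∀ {v} → ¬ v ↦* x → Terminating v → Terminating′ v
  terminating-avoiding v↛x (acc rs) = acc λ e → case ↦′-cases e of λ where
    (inj₁ (refl , _)) → contradiction ε v↛x
    (inj₂ (_ , r)) → terminating-avoiding (v↛x ∘ (r ◅_)) (rs r)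

  update-terminating : (∀ u → Terminating u) → (∀ {y} → new ≡ just y → ¬ y ↦* x) → ∀ u → Terminating′ u
  update-terminating terminating safe u = go (terminating u)
    where
      go : ∀ {u} → Terminating u → Terminating′ u
      go (acc rs) = acc λ e → case ↦′-cases e of λ where
        (inj₁ (refl , new≡y)) → terminating-avoiding (safe new≡y) (terminating _)
        (inj₂ (_ , r)) → go (rs r)

module Forests {N : ℕ} (V : Arcs N) where

  record LabelledForest (k : ℕ) : Set where
    field
      parent : Parent N

    open ParentMap parent public

    field
      parent⊆V : ∀ {u w} → u ↦ w → V u w
      terminating : ∀ u → Terminating u
      label : Fin N → Fin k
      label-↦ : ∀ {u w} → u ↦ w → label u ≡ label w
      label-injectiveOnRoots : ∀ {r s} → IsRoot r → IsRoot s → label r ≡ label s → r ≡ s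
      label-surjective : ∀ t → ∃ λ u → label u ≡ t

    acyclic : ∀ u → ¬ TransClosure _↦_ u u
    acyclic = terminating⇒acyclic terminating

    label-↦* : ∀ {u v} → u ↦* v → label u ≡ label v
    label-↦* = Star.fold (λ u v → label u ≡ label v) (trans ∘ label-↦) refl

    label-wconn : ∀ {u v} → WConn _↦_ u v → label u ≡ label v
    label-wconn = Star.fold (λ u v → label u ≡ label v) step refl
      where
        step : ∀ {u v w} → SymClosure _↦_ u v → label v ≡ label w → label u ≡ label w
        step (fwd r) = trans (label-↦ r)
        step (bwd r) = trans (sym (label-↦ r))

    root : Fin N → Fin N
    root u = proj₁ (rootOf (terminating u))

    root-isRoot : ∀ u → IsRoot (root u)
    root-isRoot u = proj₁ (proj₂ (rootOf (terminating u)))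

    ↦*-root : ∀ u → u ↦* root u
    ↦*-root u = proj₂ (proj₂ (rootOf (terminating u)))

    root-unique : ∀ {u v} → label u ≡ label v → root u ≡ root v
    root-unique {u} {v} eq = label-injectiveOnRoots (root-isRoot u) (root-isRoot v)
      (trans (sym (label-↦* (↦*-root u))) (trans eq (label-↦* (↦*-root v))))

    wconn-label : ∀ {u v} → label u ≡ label v → WConn _↦_ u v
    wconn-label {u} {v} eq =
      Star.map fwd (↦*-root u) ◅◅
      subst (λ r → WConn _↦_ r v) (sym (root-unique eq))
            (Star.reverse (Sym.symmetric _↦_) (Star.map fwd (↦*-root v)))

    inFk : InFk V k _↦_
    inFk = ((λ _ _ → parent⊆V) , (λ _ _ _ → ∈⊤ , ∈⊤) , (λ _ _ _ → ↦-deterministic) , acyclic) ,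
           label , label-surjective , λ _ _ → mk⇔ wconn-label label-wconn

  fromInFk : ∀ {k F} (F∈ : InFk V k F) →
             ¬ ¬ (Σ (LabelledForest k) λ G → LabelledForest.parent G Represents F ×
                                             LabelledForest.label G ≡ proj₁ (proj₂ F∈))
  fromInFk {k} {F} ((F⊆V , _ , outdeg , acyclicF) , c , c-surjective , c⇔wconn) =
    ¬¬-map (λ (p , p≈F) → forest p p≈F , p≈F , refl) (¬¬-parentMap outdeg)
    where
      forest : (p : Parent N) → p Represents F → LabelledForest k
      forest p p≈F = record
        { parent = p
        ; parent⊆V = F⊆V _ _ ∘ Equivalence.to (p≈F _ _)
        ; terminating = acyclic⇒terminating (λ u → acyclicF u ∘ ⁺-map (Equivalence.to (p≈F _ _)))
        ; label = c
        ; label-↦ = λ r → Equivalence.from (c⇔wconn _ _) (fwd (Equivalence.to (p≈F _ _) r) ◅ ε)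
        ; label-injectiveOnRoots = injectiveOnRoots
        ; label-surjective = c-surjective
        }
        where
          open ParentMap p using (IsRoot; root-↦*; acyclic⇒terminating)
          open DeterministicRelation F (outdeg _ _ _) using (wconn⇒meet)

          injectiveOnRoots : ∀ {r s} → IsRoot r → IsRoot s → c r ≡ c s → r ≡ s
          injectiveOnRoots root-r root-s eq with wconn⇒meet (Equivalence.to (c⇔wconn _ _) eq)
          ... | m , r⇝m , s⇝m =
            trans (root-↦* root-r (Star.map (Equivalence.from (p≈F _ _)) r⇝m))
                  (sym (root-↦* root-s (Star.map (Equivalence.from (p≈F _ _)) s⇝m)))

  module Attach {k} (G : LabelledForest k) {x y} (Vxy : V x y) (y↛x : ¬ LabelledForest._↦*_ G y x) where
    open LabelledForest G
    open Update parent x (just y) public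

    p′⊆V : ∀ {u w} → p′ u ≡ just w → V u w
    p′⊆V e with ↦′-cases e
    ... | inj₁ (refl , refl) = Vxy
    ... | inj₂ (_ , r) = parent⊆V r

    p′-terminating : ∀ u → ParentMap.Terminating p′ u
    p′-terminating = update-terminating terminating λ { refl → y↛x }

  -- Redirecting the arc out of the non-root x to y moves everything above x into the tree of y;
  -- the old tree of x keeps its root.
  module Reattach {k} (G : LabelledForest k) {x y z} (x↦z : LabelledForest._↦_ G x z) (Vxy : V x y)
                  (y↛x : ¬ LabelledForest._↦*_ G y x) where
    open LabelledForest G
    open Attach G Vxy y↛x public

    label′ : Fin N → Fin k
    label′ v with terminating v ↦*? x
    ... | yes _ = label y
    ... | no _ = label v

    label′-reaching : ∀ {v} → v ↦* x → label′ v ≡ label y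
    label′-reaching {v} v⇝x with terminating v ↦*? x
    ... | yes _ = refl
    ... | no v↛x = contradiction v⇝x v↛x

    label′-avoiding : ∀ {v} → ¬ v ↦* x → label′ v ≡ label v
    label′-avoiding {v} v↛x with terminating v ↦*? x
    ... | yes v⇝x = contradiction v⇝x v↛x
    ... | no _ = refl

    label′-↦ : ∀ {u w} → p′ u ≡ just w → label′ u ≡ label′ w
    label′-↦ {u} e with ↦′-cases e
    ... | inj₁ (refl , refl) = trans (label′-reaching ε) (sym (label′-avoiding y↛x))
    ... | inj₂ (u≢x , r) = case terminating u ↦*? x of λ where
      (yes u⇝x) → trans (label′-reaching u⇝x) (sym (label′-reaching (*-tail u⇝x u≢x r)))
      (no u↛x) → trans (label′-avoiding u↛x) (trans (label-↦ r) (sym (label′-avoiding (u↛x ∘ (r ◅_)))))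

    root′⇒root : ∀ {r} → p′ r ≡ nothing → IsRoot r × ¬ r ↦* x
    root′⇒root e with root′-cases e
    ... | inj₂ (r≢x , root-r) = root-r , r≢x ∘ root-↦* root-r

    root-avoids : ∀ u → ¬ root u ↦* x
    root-avoids u r⇝x with root-↦* (root-isRoot u) r⇝x
    ... | refl = root-¬↦ (root-isRoot u) x↦z

    forest : LabelledForest k
    forest = record
      { parent = p′
      ; parent⊆V = p′⊆V
      ; terminating = p′-terminating
      ; label = label′
      ; label-↦ = label′-↦
      ; label-injectiveOnRoots = λ root-r root-s eq →
          let (root-r , r↛x) = root′⇒root root-r
              (root-s , s↛x) = root′⇒root root-s
          in label-injectiveOnRoots root-r root-s
               (trans (sym (label′-avoiding r↛x)) (trans eq (label′-avoiding s↛x)))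
      ; label-surjective = λ t → let (u , eq) = label-surjective t in
          root u , trans (label′-avoiding (root-avoids u)) (trans (sym (label-↦* (↦*-root u))) eq)
      }

  merge : ∀ {m} (G : LabelledForest (suc (suc m))) {x y} → LabelledForest.IsRoot G x → V x y →
          LabelledForest.label G y ≢ LabelledForest.label G x → LabelledForest (suc m)
  merge G {x} {y} root-x Vxy ly≢lx = record
    { parent = p′
    ; parent⊆V = p′⊆V
    ; terminating = p′-terminating
    ; label = identify ∘ label
    ; label-↦ = identify-↦
    ; label-injectiveOnRoots = λ root-r root-s eq →
        let (root-r , lr≢lx) = root′-label root-r
            (root-s , ls≢lx) = root′-label root-s
        in label-injectiveOnRoots root-r root-s (identify-injective lr≢lx ls≢lx eq)
    ; label-surjective = λ s → let (u , eq) = label-surjective (punchIn (label x) s) in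
        u , trans (cong identify eq) (identify-surjective s)
    }
    where
      open LabelledForest G
      open Attach G Vxy (ly≢lx ∘ label-↦*)
      open Identify (ly≢lx ∘ sym)

      identify-↦ : ∀ {u w} → p′ u ≡ just w → identify (label u) ≡ identify (label w)
      identify-↦ e with ↦′-cases e
      ... | inj₁ (refl , refl) = identify-i≡j
      ... | inj₂ (_ , r) = cong identify (label-↦ r)

      root′-label : ∀ {r} → p′ r ≡ nothing → IsRoot r × label r ≢ label x
      root′-label e with root′-cases e
      ... | inj₂ (r≢x , root-r) = root-r , r≢x ∘ label-injectiveOnRoots root-r root-x

  -- Cut the arc out of w and hang the root ρ below w: the same trees, now rooted at w.
  reroot : ∀ {k} (G : LabelledForest k) {ρ w} → LabelledForest.IsRoot G ρ → V ρ w →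
           LabelledForest.label G w ≡ LabelledForest.label G ρ →
           Σ (LabelledForest k) λ G′ → LabelledForest.label G′ ≡ LabelledForest.label G ×
                                      LabelledForest.IsRoot G′ w
  reroot G {ρ} {w} root-ρ Vρw lw≡lρ with ρ ≟ w
  ... | yes refl = G , refl , root-ρ
  ... | no ρ≢w = G′ , refl , trans (P₂.p′-elsewhere (ρ≢w ∘ sym)) P₁.p′-at
    where
      open LabelledForest G
      module P₁ = Update parent w nothing
      module P₂ = Update P₁.p′ ρ (just w)

      arc-cases : ∀ {u v} → P₂.p′ u ≡ just v → (u ≡ ρ × v ≡ w) ⊎ u ↦ v
      arc-cases e with P₂.↦′-cases e
      ... | inj₁ (refl , refl) = inj₁ (refl , refl)
      ... | inj₂ (_ , e₁) with P₁.↦′-cases e₁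
      ...   | inj₂ (_ , r) = inj₂ r

      root-cases : ∀ {r} → P₂.p′ r ≡ nothing → r ≡ w ⊎ (r ≢ ρ × IsRoot r)
      root-cases e with P₂.root′-cases e
      ... | inj₂ (r≢ρ , e₁) with P₁.root′-cases e₁
      ...   | inj₁ (refl , _) = inj₁ refl
      ...   | inj₂ (_ , root-r) = inj₂ (r≢ρ , root-r)

      injectiveOnRoots : ∀ {r s} → P₂.p′ r ≡ nothing → P₂.p′ s ≡ nothing → label r ≡ label s → r ≡ s
      injectiveOnRoots root-r root-s eq with root-cases root-r | root-cases root-s
      ... | inj₁ refl | inj₁ refl = refl
      ... | inj₁ refl | inj₂ (s≢ρ , root-s) =
        contradiction (label-injectiveOnRoots root-s root-ρ (trans (sym eq) lw≡lρ)) s≢ρ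
      ... | inj₂ (r≢ρ , root-r) | inj₁ refl =
        contradiction (label-injectiveOnRoots root-r root-ρ (trans eq lw≡lρ)) r≢ρ
      ... | inj₂ (_ , root-r) | inj₂ (_ , root-s) = label-injectiveOnRoots root-r root-s eq

      G′ : LabelledForest _
      G′ = record
        { parent = P₂.p′
        ; parent⊆V = [ (λ { (refl , refl) → Vρw }) , parent⊆V ]′ ∘ arc-cases
        ; terminating = P₂.update-terminating (P₁.update-terminating terminating λ ())
                          λ { refl → ρ≢w ∘ sym ∘ ParentMap.root-↦* P₁.p′ P₁.p′-at }
        ; label = label
        ; label-↦ = [ (λ { (refl , refl) → sym lw≡lρ }) , label-↦ ]′ ∘ arc-cases
        ; label-injectiveOnRoots = injectiveOnRoots
        ; label-surjective = label-surjective
        }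

-- The atom lies in one tree of each forest

Separates : ∀ {n} → Subset n → Fin n → Fin n → Set
Separates A a b = (a ∈ A × b ∉ A) ⊎ (a ∉ A × b ∈ A)

module _ {n} {A : Subset n} {a b : Fin n} where

  separates-sym : Separates A a b → Separates A b a
  separates-sym (inj₁ (a∈ , b∉)) = inj₂ (b∉ , a∈)
  separates-sym (inj₂ (a∉ , b∈)) = inj₁ (b∈ , a∉)

  ∁-separates : Separates (∁ A) a b → Separates A a b
  ∁-separates (inj₁ (a∈ , b∉)) = inj₂ (x∈∁p⇒x∉p a∈ , x∉∁p⇒x∈p b∉)
  ∁-separates (inj₂ (a∉ , b∈)) = inj₁ (x∉∁p⇒x∈p a∉ , x∈∁p⇒x∉p b∈)

∩-separates : ∀ {n} {A B : Subset n} {a b} → Separates (A ∩ B) a b → Separates A a b ⊎ Separates B a b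
∩-separates {A = A} {B} (inj₁ (a∈ , b∉)) = ∩-separatesˡ a∈ b∉
  where
    ∩-separatesˡ : ∀ {a b} → a ∈ A ∩ B → b ∉ A ∩ B → Separates A a b ⊎ Separates B a b
    ∩-separatesˡ {a} {b} a∈ b∉ with b ∈? A
    ... | yes b∈A = inj₂ (inj₁ (proj₂ (x∈p∩q⁻ A B a∈) , λ b∈B → b∉ (x∈p∩q⁺ (b∈A , b∈B))))
    ... | no b∉A = inj₁ (inj₁ (proj₁ (x∈p∩q⁻ A B a∈) , b∉A))
∩-separates {A = A} {B} (inj₂ (a∉ , b∈)) with ∩-separates {A = A} {B} (inj₁ (b∈ , a∉))
... | inj₁ s = inj₁ (separates-sym s)
... | inj₂ s = inj₂ (separates-sym s)

fibre : ∀ {n k} → (Fin n → Fin k) → Fin n → Subset n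
fibre c a = tabulate λ v → does (c v ≟ c a)

module _ {n k} (c : Fin n → Fin k) (a : Fin n) {v : Fin n} where

  ∈-fibre⁻ : v ∈ fibre c a → c v ≡ c a
  ∈-fibre⁻ v∈ with c v ≟ c a | trans (sym (lookup∘tabulate _ v)) ([]=⇒lookup v∈)
  ... | yes eq | _ = eq
  ... | no _ | ()

  ∈-fibre⁺ : c v ≡ c a → v ∈ fibre c a
  ∈-fibre⁺ eq = lookup⇒[]= v _ (trans (lookup∘tabulate _ v) (dec-true (c v ≟ c a) eq))

module Atoms {N : ℕ} (V : Arcs N) {k : ℕ} {E : Subset N} (atom : IsAtom V k E) where
  open Forests V

  separatingTree : ∀ {A a b} → InAlgebra V k A → Separates A a b →
                   ∃ λ T → TreeVertexSet V k T × Separates T a b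
  separatingTree (gen T) s = _ , T , s
  separatingTree (compl A) s = separatingTree A (∁-separates s)
  separatingTree (inter A B) s = [ separatingTree A , separatingTree B ]′ (∩-separates s)

  component∈algebra : ∀ {R} (R∈ : InFk V k R) a → InAlgebra V k (fibre (proj₁ (proj₂ R∈)) a)
  component∈algebra {R} R∈@(_ , c , _ , c⇔wconn) a = gen (R , R∈ , a , λ j → mk⇔
    (Equivalence.to (c⇔wconn a j) ∘ sym ∘ ∈-fibre⁻ c a)
    (∈-fibre⁺ c a ∘ sym ∘ Equivalence.from (c⇔wconn a j)))

  atom⊆component : ∀ {R} (R∈ : InFk V k R) {a y} → a ∈ E → y ∈ E →
                   proj₁ (proj₂ R∈) y ≡ proj₁ (proj₂ R∈) a
  atom⊆component R∈@(_ , c , _) {a} {y} a∈E y∈E with proj₂ (proj₂ atom) _ (component∈algebra R∈ a)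
  ... | inj₁ E∩C≡∅ = contradiction (subst (a ∈_) E∩C≡∅ (x∈p∩q⁺ (a∈E , ∈-fibre⁺ c a refl))) ∉⊥
  ... | inj₂ E∩C≡E = ∈-fibre⁻ c a (proj₂ (x∈p∩q⁻ E _ (subst (y ∈_) (sym E∩C≡E) y∈E)))

  atom⊆tree : (G : LabelledForest k) → ∀ {a y} → a ∈ E → y ∈ E →
              LabelledForest.label G y ≡ LabelledForest.label G a
  atom⊆tree G = atom⊆component (LabelledForest.inFk G)

  separatingForest : ∀ {a b} → a ∈ E → b ∉ E →
                     ¬ ¬ (Σ (LabelledForest k) λ G → LabelledForest.label G a ≢ LabelledForest.label G b)
  separatingForest a∈E b∉E with separatingTree (proj₁ (proj₂ atom)) (inj₁ (a∈E , b∉E))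
  ... | T , (R , R∈@(_ , c , _ , c⇔wconn) , i , T⇔) , s =
    ¬¬-map (λ (G , _ , label≡c) → G , subst (λ ℓ → ℓ _ ≢ ℓ _) (sym label≡c) (labels-differ s))
           (fromInFk R∈)
    where
      ∈T⇒≡ : ∀ {v} → v ∈ T → c i ≡ c v
      ∈T⇒≡ = Equivalence.from (c⇔wconn i _) ∘ Equivalence.to (T⇔ _)

      ≡⇒∈T : ∀ {v} → c i ≡ c v → v ∈ T
      ≡⇒∈T = Equivalence.from (T⇔ _) ∘ Equivalence.to (c⇔wconn i _)

      labels-differ : ∀ {a b} → Separates T a b → c a ≢ c b
      labels-differ (inj₁ (a∈ , b∉)) eq = b∉ (≡⇒∈T (trans (∈T⇒≡ a∈) eq))
      labels-differ (inj₂ (a∉ , b∈)) eq = a∉ (≡⇒∈T (trans (∈T⇒≡ b∈) (sym eq)))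

-- Forests with the fewest trees

module FewestTrees {N : ℕ} (V : Arcs N) {m : ℕ} (no-fewer : ¬ FkNonempty V (suc m)) where
  open Forests V

  module _ (G : LabelledForest (suc (suc m))) where
    open LabelledForest G

    root-arc-within-tree : ∀ {x y} → IsRoot x → V x y → label y ≡ label x
    root-arc-within-tree {x} {y} root-x Vxy with label y ≟ label x
    ... | yes eq = eq
    ... | no ly≢lx = contradiction (_ , LabelledForest.inFk (merge G root-x Vxy ly≢lx)) no-fewer

  root-closed : (G : LabelledForest (suc (suc m))) → ∀ {ρ v} → LabelledForest.IsRoot G ρ → Star V ρ v →
                LabelledForest.label G v ≡ LabelledForest.label G ρ
  root-closed G root-ρ ε = refl
  root-closed G {ρ} {v} root-ρ (_◅_ {j = w} Vρw w⇝v)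
    with reroot G root-ρ Vρw (root-arc-within-tree G root-ρ Vρw)
  ... | G′ , label′≡label , root-w = begin
    label v                     ≡⟨ cong-app label′≡label v ⟨
    LabelledForest.label G′ v   ≡⟨ root-closed G′ root-w w⇝v ⟩
    LabelledForest.label G′ w   ≡⟨ cong-app label′≡label w ⟩
    label w                     ≡⟨ root-arc-within-tree G root-ρ Vρw ⟩
    label ρ                     ∎
    where
      open LabelledForest G using (label)
      open ≡-Reasoning

  module _ {E : Subset N} (atom : IsAtom V (suc (suc m)) E) where
    open Atoms V atom

    module ParentInAtom (F : LabelledForest (suc (suc m))) {a b x} (a∈E : a ∈ E) (b∈E : b ∈ E)
                        (a↦x : LabelledForest._↦_ F a x) (b↛a : ¬ LabelledForest._↦*_ F b a) where
      module F = LabelledForest F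

      Splits : LabelledForest (suc (suc m)) → Set
      Splits G = LabelledForest.label G a ≢ LabelledForest.label G x

      ReachesA : Fin N → Set
      ReachesA y = ∀ G → Splits G → LabelledForest._↦*_ G y a

      module _ (G : LabelledForest (suc (suc m))) (splits : Splits G) where
        open LabelledForest G

        b-reaches-a : b ↦* a
        b-reaches-a with terminating b ↦*? a
        ... | yes b⇝a = b⇝a
        ... | no b↛a′ with parent a in e
        ...   | nothing = contradiction (sym (root-arc-within-tree G e (F.parent⊆V a↦x))) splits
        ...   | just _ = contradiction (begin
            label a      ≡⟨ atom⊆tree G a∈E b∈E ⟨
            label b      ≡⟨ R.label′-avoiding b↛a′ ⟨
            R.label′ b   ≡⟨ atom⊆tree R.forest a∈E b∈E ⟩
            R.label′ a   ≡⟨ R.label′-reaching ε ⟩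
            label x      ∎) splits
          where
            module R = Reattach G e (F.parent⊆V a↦x) (splits ∘ sym ∘ label-↦*)
            open ≡-Reasoning

      module _ {z z′} (z-reaches : ReachesA z) (z≢a : z ≢ a) (z↦z′ : F._↦_ z z′)
               (G : LabelledForest (suc (suc m))) (splits : Splits G) where
        open LabelledForest G

        reaches-a-step : z′ ↦* a
        reaches-a-step with terminating z′ ↦*? a
        ... | yes z′⇝a = z′⇝a
        ... | no z′↛a = contradiction (R.↦′*-avoiding z′↛z z′⇝′a) z′↛a
          where
            z⇝a : z ↦* a
            z⇝a = z-reaches G splits

            z′↛z : ¬ z′ ↦* z
            z′↛z = z′↛a ∘ (_◅◅ z⇝a)

            module R = Reattach G (proj₂ (*-first-step z⇝a z≢a)) (F.parent⊆V z↦z′) z′↛z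

            a↛z : ¬ a ↦* z
            a↛z a⇝z = z≢a (sym (acyclic⇒antisym acyclic a⇝z z⇝a))

            x↛z : ¬ x ↦* z
            x↛z x⇝z = splits (sym (label-↦* (x⇝z ◅◅ z⇝a)))

            splits′ : Splits R.forest
            splits′ eq = splits (trans (sym (R.label′-avoiding a↛z)) (trans eq (R.label′-avoiding x↛z)))

            z′⇝′a : LabelledForest._↦*_ R.forest z′ a
            z′⇝′a = LabelledForest.*-tail R.forest (z-reaches R.forest splits′) z≢a R.p′-at

      reaches-along : ∀ {y r} → ReachesA y → ¬ F._↦*_ y a → F._↦*_ y r → ReachesA r
      reaches-along y-reaches y↛a ε = y-reaches
      reaches-along y-reaches y↛a (y↦y′ ◅ y′⇝r) =
        reaches-along (reaches-a-step y-reaches (λ { refl → y↛a ε }) y↦y′) (y↛a ∘ (y↦y′ ◅_)) y′⇝r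

      x∉E-absurd : x ∉ E → ⊥
      x∉E-absurd x∉E = separatingForest a∈E x∉E λ (G , splits) → splits (a~x G splits)
        where
          a~x : (G : LabelledForest (suc (suc m))) → Splits G →
                LabelledForest.label G a ≡ LabelledForest.label G x
          a~x G splits = begin
            G.label a   ≡⟨ G.label-↦* r⇝a ⟨
            G.label r   ≡⟨ root-closed G (G.root-isRoot x) ρ⇝r ⟩
            G.label ρ   ≡⟨ G.label-↦* (G.↦*-root x) ⟨
            G.label x   ∎
            where
              module G = LabelledForest G
              open ≡-Reasoning

              r = F.root b
              ρ = G.root x

              r⇝a : G._↦*_ r a
              r⇝a = reaches-along b-reaches-a b↛a (F.↦*-root b) G splits

              r⇝ρ : Star V r ρ
              r⇝ρ = Star.map G.parent⊆V r⇝a ◅◅ F.parent⊆V a↦x ◅ Star.map G.parent⊆V (G.↦*-root x)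

              F-root-ρ : F.root ρ ≡ r
              F-root-ρ = F.label-injectiveOnRoots (F.root-isRoot ρ) (F.root-isRoot b)
                (trans (sym (F.label-↦* (F.↦*-root ρ))) (root-closed F (F.root-isRoot b) r⇝ρ))

              ρ⇝r : Star V ρ r
              ρ⇝r = Star.map F.parent⊆V (subst (F._↦*_ ρ) F-root-ρ (F.↦*-root ρ))

    -- F is a parent map only under ¬¬, which suffices as membership in E is decidable.
    parent-in-atom : ∀ {F} → InFk V (suc (suc m)) F →
                     ∀ {a b x} → a ∈ E → b ∈ E → F a x → ¬ Star F b a → x ∈ E
    parent-in-atom F∈ {x = x} a∈E b∈E Fax b↛a with x ∈? E
    ... | yes x∈E = x∈E
    ... | no x∉E = ⊥-elim (fromInFk F∈ λ (G , p≈F , _) →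
      ParentInAtom.x∉E-absurd G a∈E b∈E (Equivalence.from (p≈F _ _) Fax)
                                   (b↛a ∘ Star.map (Equivalence.to (p≈F _ _))) x∉E)

-- Induced subforests

module InducedSubforest {N : ℕ} {F : Arcs N} (outdeg : OutDegAtMostOne F) (acyclic : Acyclic F)
                        {E : Subset N}
                        (closed : ∀ {a b x} → a ∈ E → b ∈ E → F a x → ¬ Star F b a → x ∈ E) where
  open DeterministicRelation F (outdeg _ _ _)

  path-inside : ∀ {i v} → i ∈ E → v ∈ E → Star F v i → Star (Induced F E) v i
  path-inside i∈E v∈E ε = ε
  path-inside i∈E v∈E (Fvv′ ◅ v′⇝i) = (v∈E , v′∈E , Fvv′) ◅ path-inside i∈E v′∈E v′⇝i
    where
      v′∈E = closed v∈E i∈E Fvv′ λ i⇝v → acyclic _ (Fvv′ ◅⁺ (v′⇝i ◅◅ i⇝v))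

  wconn-inside : ∀ {i j m} → i ∈ E → j ∈ E → Star F i m → Star F j m → WConn (Induced F E) i j
  wconn-inside i∈E j∈E i⇝m j⇝m with *-dec-on-path _≟_ acyclic j⇝m i⇝m
  ... | yes j⇝i = Star.reverse (Sym.symmetric _) (Star.map fwd (path-inside i∈E j∈E j⇝i))
  wconn-inside i∈E j∈E ε j⇝m | no j↛i = contradiction j⇝m j↛i
  wconn-inside i∈E j∈E (Fii′ ◅ i′⇝m) j⇝m | no j↛i =
    fwd (i∈E , closed i∈E j∈E Fii′ j↛i , Fii′) ◅ wconn-inside (closed i∈E j∈E Fii′ j↛i) j∈E i′⇝m j⇝m

  induced-isTree : Nonempty E → (∀ {i j} → i ∈ E → j ∈ E → WConn F i j) → IsTree E (Induced F E)
  induced-isTree nonempty wconn =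
    ((λ _ _ (i∈E , j∈E , _) → i∈E , j∈E) ,
     (λ i j j′ (_ , _ , Fij) (_ , _ , Fij′) → outdeg i j j′ Fij Fij′) ,
     (λ i → acyclic i ∘ ⁺-map (proj₂ ∘ proj₂))) ,
    nonempty ,
    λ i j i∈E j∈E → let (m , i⇝m , j⇝m) = wconn⇒meet (wconn i∈E j∈E) in wconn-inside i∈E j∈E i⇝m j⇝m

theorem7 : (N : ℕ) (V : Arcs N) → Loopless V → (k : ℕ) → 2 ≤ k → k ≤ N →
    FkNonempty V k → ¬ FkNonempty V (k ∸ 1) →
    (E : Subset N) → IsAtom V k E →
    (F : Arcs N) → InFk V k F → IsTree E (Induced F E)
theorem7 N V _ (suc (suc m)) (s≤s (s≤s z≤n)) _ _ no-fewer E atom F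
         F∈@((_ , _ , outdeg , acyclic) , _ , _ , c⇔wconn) =
  induced-isTree (proj₁ atom) λ {i} {j} i∈E j∈E →
    Equivalence.to (c⇔wconn i j) (sym (atom⊆component F∈ i∈E j∈E))
  where
    open FewestTrees V no-fewer using (parent-in-atom)
    open Atoms V atom using (atom⊆component)
    open InducedSubforest outdeg acyclic (parent-in-atom atom F∈)
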